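{- For $w, w' \in \widehat{\mathfrak{H}}^{1}$ it holds that $\mathcal{L}(w \mathbin{\sqcup\!\sqcup}_\hbar w')=\mathcal{L}(w)\mathcal{L}(w')$.
   Context: Fix $q\in\mathbb{C}$ with $|q|<1$, $[m]=(1-q^m)/(1-q)$. Let $\widehat{\mathbb{N}}=\mathbb{N}\sqcup\{\hat1\}$; put $F_k(m)=q^{(k-1)m}/[m]^k$ for $k\in\mathbb{N}$ and $F_{\hat1}(m)=q^m/[m]$. For ${\bf k}=(k_1,\ldots,k_r)\in\widehat{\mathbb{N}}^r$ let $L_{\bf k}(t)=\sum_{m_1>\cdots>m_r>0}t^{m_1}\prod_a F_{k_a}(m_a)\in\mathbb{C}[[t]]$, $L_\emptyset=1$. Let $\mathcal{C}=\mathbb{Q}[\hbar,\hbar^{ -1}]$, $\mathfrak{H}=\mathcal{C}\langle a,b\rangle$, $e_{\hat1}=ab$, $e_k=a^{k-1}(a+\hbar)b$ ($k\in\mathbb{N}$), $e_{\bf k}=e_{k_1}\cdots e_{k_r}$, and $\widehat{\mathfrak{H}}^1$ the subalgebra freely generated by $\{e_k\}_{k\in\widehat{\mathbb{N}}}$. With $\hbar$ acting on $\mathbb{C}[[t]]$ as multiplication by $1-q$, $\mathcal{L}:\widehat{\mathfrak{H}}^1\to\mathbb{C}[[t]]$ is the $\mathcal{C}$-module homomorphism $e_{\bf k}\mapsto L_{\bf k}(t)$. The product $\mathbin{\sqcup\!\sqcup}_\hbar$ is the $\mathcal{C}$-bilinear map on $\mathfrak{H}$ with $aw\mathbin{\sqcup\!\sqcup}_\hbar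 aw'=a(aw\mathbin{\sqcup\!\sqcup}_\hbar w'+w\mathbin{\sqcup\!\sqcup}_\hbar aw'+\hbar\,w\mathbin{\sqcup\!\sqcup}_\hbar w')$, $bw\mathbin{\sqcup\!\sqcup}_\hbar w'=w\mathbin{\sqcup\!\sqcup}_\hbar bw'=b(w\mathbin{\sqcup\!\sqcup}_\hbar w')$, $1\mathbin{\sqcup\!\sqcup}_\hbar w=w\mathbin{\sqcup\!\sqcup}_\hbar 1=w$. For $w,w'\in\widehat{\mathfrak{H}}^1$ one has $w\mathbin{\sqcup\!\sqcup}_\hbar w'\in\widehat{\mathfrak{H}}^1$, so the left side is defined. -}

module Defs where

open import Level using (Level)
open import Data.Nat as ℕ using (ℕ; zero; suc; _≤_; _∸_)
open import Data.Integer as ℤ using (ℤ; +_; -[1+_])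
open import Data.Rational as ℚ using (ℚ)
open import Data.List using (List; []; _∷_; _++_; map; concatMap; replicate; [_])
open import Data.List.Properties using (≡-dec)
open import Data.Product using (_×_; _,_)
open import Relation.Binary.PropositionalEquality using (_≡_; refl)
open import Relation.Nullary using (Dec; yes; no)
open import Algebra.Bundles using (CommutativeRing)

-- The free noncommutative algebra 𝔥 = 𝒞⟨a,b⟩, 𝒞 = ℚ[ℏ,ℏ⁻¹].
-- An element is represented as a finite formal sum of terms  c ℏⁿ w
-- (c ∈ ℚ, n ∈ ℤ, w a word in a,b); equality of elements of 𝔥 is
-- equality of all coefficients (see _≈ₕ_).

data AB : Set where
  a b : AB

_≟AB_ : (x y : AB) → Dec (x ≡ y)
a ≟AB a = yes refl
a ≟AB b = no (λ ())
b ≟AB a = no (λ ())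
b ≟AB b = yes refl

Word : Set
Word = List AB

_≟W_ : (u v : Word) → Dec (u ≡ v)
_≟W_ = ≡-dec _≟AB_

Term : Set
Term = ℚ × ℤ × Word

Poly : Set
Poly = List Term

coeff : Poly → Word → ℤ → ℚ
coeff [] v n = ℚ.0ℚ
coeff ((c , m , w) ∷ p) v n with w ≟W v | m ℤ.≟ n
... | yes _ | yes _ = c ℚ.+ coeff p v n
... | _     | _     = coeff p v n

_≈ₕ_ : Poly → Poly → Set
p ≈ₕ p' = ∀ (v : Word) (n : ℤ) → coeff p v n ≡ coeff p' v n

-- The ℏ-shuffle product on words: w ⧢ w' = Σ ℏʲ v, returned as the
-- list of pairs (j , v) (with multiplicity).

private
  pre : AB → ℕ × Word → ℕ × Word
  pre x (j , v) = j , x ∷ v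

  incr : ℕ × Word → ℕ × Word
  incr (j , v) = suc j , v

shw : Word → Word → List (ℕ × Word)
shw []      v       = [ (0 , v) ]
shw (b ∷ u) v       = map (pre b) (shw u v)
shw (a ∷ u) []      = [ (0 , a ∷ u) ]
shw (a ∷ u) (b ∷ v) = map (pre b) (shw (a ∷ u) v)
shw (a ∷ u) (a ∷ v) =
  map (pre a) (shw (a ∷ u) v ++ (shw u (a ∷ v) ++ map incr (shw u v)))

_⧢ℏ_ : Poly → Poly → Poly
p ⧢ℏ p' = concatMap (λ t → concatMap (λ t' → shTerm t t') p') p
  where
  shTerm : Term → Term → Poly
  shTerm (c , n , u) (c' , n' , u') =
    map (λ { (j , v) → (c ℚ.* c' , n ℤ.+ n' ℤ.+ + j , v) }) (shw u u')

data Idx : Set where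
  hat : Idx
  pos : (k : ℕ) → 1 ≤ k → Idx

-- an element of 𝔥̂¹ as a 𝒞-linear combination of the words e_𝐤:
-- a finite formal sum of terms  c ℏⁿ e_𝐤
ETerm : Set
ETerm = ℚ × ℤ × List Idx

EPoly : Set
EPoly = List ETerm

-- e_1̂ = ab,  e_k = a^{k-1}(a+ℏ)b = aᵏb + ℏ a^{k-1} b
eGen : Idx → Poly
eGen hat       = [ (ℚ.1ℚ , + 0 , a ∷ b ∷ []) ]
eGen (pos k _) = (ℚ.1ℚ , + 0 , replicate k a ++ [ b ])
               ∷ (ℚ.1ℚ , + 1 , replicate (k ∸ 1) a ++ [ b ]) ∷ []

_·ₕ_ : Poly → Poly → Poly
p ·ₕ p' = concatMap (λ { (c , n , u) →
            map (λ { (c' , n' , u') → (c ℚ.* c' , n ℤ.+ n' , u ++ u') }) p' }) p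

eWord : List Idx → Poly
eWord []       = [ (ℚ.1ℚ , + 0 , []) ]
eWord (k ∷ ks) = eGen k ·ₕ eWord ks

ι : EPoly → Poly
ι u = concatMap (λ { (c , n , ks) →
        map (λ { (c' , n' , w) → (c ℚ.* c' , n ℤ.+ n' , w) }) (eWord ks) }) u

-- The series side, over a commutative ring R (playing the role of ℂ)
-- with a ring map φ : ℚ → R, an element q, inverses inv m of [m]
-- (m ≥ 1) and an inverse hinv of 1 - q.

module Setup {c ℓ : Level} (R : CommutativeRing c ℓ)
             (φ : ℚ → CommutativeRing.Carrier R)
             (q : CommutativeRing.Carrier R)
             (inv : ℕ → CommutativeRing.Carrier R)
             (hinv : CommutativeRing.Carrier R) where
  open CommutativeRing R

  infixr 8 _^_
  _^_ : Carrier → ℕ → Carrier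
  x ^ zero  = 1#
  x ^ suc n = x * (x ^ n)

  Σ< : ℕ → (ℕ → Carrier) → Carrier
  Σ< zero    f = 0#
  Σ< (suc M) f = Σ< M f + f M

  -- [m] = (1 - q^m)/(1 - q) = 1 + q + ... + q^{m-1}
  qint : ℕ → Carrier
  qint m = Σ< m (λ i → q ^ i)

  F : Idx → ℕ → Carrier
  F hat       m = (q ^ m) * inv m
  F (pos k _) m = (q ^ ((k ∸ 1) ℕ.* m)) * (inv m ^ k)

  -- formal power series in t: coefficient sequences
  Series : Set c
  Series = ℕ → Carrier

  _≈ₛ_ : Series → Series → Set ℓ
  f ≈ₛ g = ∀ N → f N ≈ g N

  _⋆_ : Series → Series → Series
  (f ⋆ g) N = Σ< (suc N) (λ i → f i * g (N ∸ i))

  -- H 𝐤 M = Σ_{M > m₁ > ⋯ > m_r > 0} Π F_{k_a}(m_a)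
  H : List Idx → ℕ → Carrier
  H []       M = 1#
  H (k ∷ ks) M = Σ< M term
    where
    term : ℕ → Carrier
    term zero    = 0#
    term (suc m) = F k (suc m) * H ks (suc m)

  -- L_𝐤(t) = Σ_{m₁ > ⋯ > m_r > 0} t^{m₁} Π F_{k_a}(m_a), L_∅ = 1
  Lw : List Idx → Series
  Lw []       zero    = 1#
  Lw []       (suc N) = 0#
  Lw (k ∷ ks) zero    = 0#
  Lw (k ∷ ks) (suc N) = F k (suc N) * H ks (suc N)

  hpow : ℤ → Carrier
  hpow (+ n)     = (1# - q) ^ n
  hpow -[1+ n ]  = hinv ^ suc n

  L : EPoly → Series
  L []                   N = 0#
  L ((c , n , ks) ∷ u)   N = φ c * hpow n * Lw ks N + L u N

module Submission where

-- Letters act on power series: b by t/(1-t) (Bop, partial sums) and a by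
-- multiplying the t^N-coefficient with ϖ(N) = q^N/[N] (Aop, killing t⁰); a
-- word w is realized as S w = w·1.  The Cauchy product obeys
--   Bop f ⋆ g = Bop (f ⋆ g) = f ⋆ Bop g,
--   Aop f ⋆ Aop g = Aop (Aop f ⋆ g + f ⋆ Aop g + ℏ f ⋆ g)   if f₀ = g₀ = 0,
-- the latter by the q-identity ϖ(i)ϖ(j) = ϖ(i+j)(ϖ(i)+ϖ(j)+ℏ).  These mirror
-- the clauses of the ℏ-shuffle, so by induction S turns the shuffle of two
-- admissible words (no final a) into ⋆.  Its linear extension Λ to 𝔥
-- (ℏ ↦ 1-q) respects equality of coefficients and is multiplicative on ⧢ℏ.
-- Finally Λ(e_𝐤) = L_𝐤, because e_1̂ = ab and e_k = aᵏb + ℏa^{k-1}b match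
-- F_1̂(m) = ϖ(m) and F_k(m) = ϖ(m)^k + ℏϖ(m)^{k-1}; so ℒ = Λ ∘ ι and the
-- theorem follows.

open import Defs
open import Level using (Level)
open import Function using (_∘_)
open import Data.Nat as ℕ using (ℕ; zero; suc)
import Data.Nat.Properties as ℕP
open import Data.Integer as ℤ using (ℤ; +_; -[1+_])
import Data.Integer.Properties as ℤP
open import Data.Rational as ℚ using (ℚ)
open import Data.Rational.Base using (+-*-rawRing)
open import Data.Product using (_×_; _,_; proj₂)
import Data.Product.Properties as ×P
open import Data.List using (List; []; _∷_; _++_; map; replicate; [_]; concatMap; deduplicate)
open import Data.List.Relation.Unary.All using (All; []; _∷_)
import Data.List.Relation.Unary.All as All
import Data.List.Relation.Unary.All.Properties as AllP
open import Data.List.Relation.Unary.Any using (here; there)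
open import Data.List.Membership.Propositional using (_∈_)
import Data.List.Membership.Propositional.Properties as ∈P
open import Data.List.Relation.Unary.Unique.Propositional using (Unique)
open import Data.List.Relation.Unary.AllPairs using (_∷_)
open import Data.List.Relation.Unary.Unique.DecPropositional.Properties using (deduplicate-!)
open import Data.Empty using (⊥-elim)
open import Relation.Nullary using (¬_; Dec; yes; no)
open import Relation.Binary.PropositionalEquality as P using (_≡_)
open import Algebra.Bundles using (CommutativeRing)
open import Algebra.Morphism.Structures using (module RingMorphisms)

-- Admissible words (those of 𝒞 ⊕ 𝔥b): every letter a is followed by another
-- letter, so removing a leading a leaves a word whose realization has zero
-- constant term, as the product rule for a requires.
data Admissible : Word → Set where
  []  : Admissible []
  b∷_ : ∀ {w} → Admissible w → Admissible (b ∷ w)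
  a∷_ : ∀ {x w} → Admissible (x ∷ w) → Admissible (a ∷ x ∷ w)

word : Term → Word
word = proj₂ ∘ proj₂

Admissibles : Poly → Set
Admissibles = All (Admissible ∘ word)

admissible-aᵏb : ∀ k {w} → Admissible w → Admissible ((replicate k a ++ [ b ]) ++ w)
admissible-aᵏb zero          adm = b∷ adm
admissible-aᵏb (suc zero)    adm = a∷ b∷ adm
admissible-aᵏb (suc (suc k)) adm = a∷ admissible-aᵏb (suc k) adm

admissible-eWord : ∀ ks → Admissibles (eWord ks)
admissible-eWord []                 = [] ∷ []
admissible-eWord (hat ∷ ks)         =
  AllP.++⁺ (AllP.map⁺ (All.map (λ adm → a∷ b∷ adm) (admissible-eWord ks))) []
admissible-eWord (pos k _ ∷ ks)     =
  AllP.++⁺ (AllP.map⁺ (All.map (admissible-aᵏb k) (admissible-eWord ks)))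
    (AllP.++⁺ (AllP.map⁺ (All.map (admissible-aᵏb (k ℕ.∸ 1)) (admissible-eWord ks))) [])

admissible-ι : ∀ u → Admissibles (ι u)
admissible-ι []                  = []
admissible-ι ((_ , _ , ks) ∷ u) = AllP.++⁺ (AllP.map⁺ (admissible-eWord ks)) (admissible-ι u)

module Realization {c ℓ : Level} (R : CommutativeRing c ℓ)
                   (φ : ℚ → CommutativeRing.Carrier R)
                   (q : CommutativeRing.Carrier R)
                   (inv : ℕ → CommutativeRing.Carrier R)
                   (hinv : CommutativeRing.Carrier R) where
  open CommutativeRing R
  open Setup R φ q inv hinv
  open import Relation.Binary.Reasoning.Setoid setoid
  open import Algebra.Solver.Ring.NaturalCoefficients.Default commutativeSemiring

  Σ-cong : ∀ M {f g : ℕ → Carrier} → (∀ i → i ℕ.< M → f i ≈ g i) → Σ< M f ≈ Σ< M g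
  Σ-cong zero    f≈g = refl
  Σ-cong (suc M) f≈g =
    +-cong (Σ-cong M (λ i i<M → f≈g i (ℕP.m<n⇒m<1+n i<M))) (f≈g M (ℕP.n<1+n M))

  Σ-cong' : ∀ M {f g : ℕ → Carrier} → (∀ i → f i ≈ g i) → Σ< M f ≈ Σ< M g
  Σ-cong' M f≈g = Σ-cong M (λ i _ → f≈g i)

  Σ-zero : ∀ M {f : ℕ → Carrier} → (∀ i → i ℕ.< M → f i ≈ 0#) → Σ< M f ≈ 0#
  Σ-zero zero    f≈0 = refl
  Σ-zero (suc M) f≈0 = trans
    (+-cong (Σ-zero M (λ i i<M → f≈0 i (ℕP.m<n⇒m<1+n i<M))) (f≈0 M (ℕP.n<1+n M)))
    (+-identityʳ 0#)

  Σ-+ : ∀ M (f g : ℕ → Carrier) → Σ< M (λ i → f i + g i) ≈ Σ< M f + Σ< M g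
  Σ-+ zero    f g = sym (+-identityˡ 0#)
  Σ-+ (suc M) f g = begin
    Σ< M (λ i → f i + g i) + (f M + g M) ≈⟨ +-congʳ (Σ-+ M f g) ⟩
    (Σ< M f + Σ< M g) + (f M + g M)      ≈⟨ solve 4 (λ x y z w → (x :+ y) :+ (z :+ w) := (x :+ z) :+ (y :+ w))
                                                     refl (Σ< M f) (Σ< M g) (f M) (g M) ⟩
    (Σ< M f + f M) + (Σ< M g + g M)      ∎

  Σ-* : ∀ M k (f : ℕ → Carrier) → Σ< M (λ i → k * f i) ≈ k * Σ< M f
  Σ-* zero    k f = sym (zeroʳ k)
  Σ-* (suc M) k f = trans (+-congʳ (Σ-* M k f)) (sym (distribˡ k _ _))

  Σ-first : ∀ M (f : ℕ → Carrier) → Σ< (suc M) f ≈ f 0 + Σ< M (f ∘ suc)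
  Σ-first zero    f = trans (+-identityˡ _) (sym (+-identityʳ _))
  Σ-first (suc M) f = trans (+-congʳ (Σ-first M f)) (+-assoc _ _ _)

  ≈ₛ-refl : ∀ {f} → f ≈ₛ f
  ≈ₛ-refl N = refl

  ≈ₛ-sym : ∀ {f g} → f ≈ₛ g → g ≈ₛ f
  ≈ₛ-sym f≈g N = sym (f≈g N)

  ≈ₛ-trans : ∀ {f g h} → f ≈ₛ g → g ≈ₛ h → f ≈ₛ h
  ≈ₛ-trans f≈g g≈h N = trans (f≈g N) (g≈h N)

  0ₛ : Series
  0ₛ _ = 0#

  δ : Series
  δ zero    = 1#
  δ (suc _) = 0#

  infixl 6 _⊕_
  infixr 7 _·_

  _⊕_ : Series → Series → Series
  (f ⊕ g) N = f N + g N

  _·_ : Carrier → Series → Series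
  (k · f) N = k * f N

  ⊕-cong : ∀ {f f' g g'} → f ≈ₛ f' → g ≈ₛ g' → (f ⊕ g) ≈ₛ (f' ⊕ g')
  ⊕-cong f≈f' g≈g' N = +-cong (f≈f' N) (g≈g' N)

  ⋆-cong : ∀ {f f' g g'} → f ≈ₛ f' → g ≈ₛ g' → (f ⋆ g) ≈ₛ (f' ⋆ g')
  ⋆-cong f≈f' g≈g' N = Σ-cong' (suc N) (λ i → *-cong (f≈f' i) (g≈g' (N ℕ.∸ i)))

  ⋆-distribʳ : ∀ f f' g → ((f ⊕ f') ⋆ g) ≈ₛ ((f ⋆ g) ⊕ (f' ⋆ g))
  ⋆-distribʳ f f' g N = trans (Σ-cong' (suc N) (λ i → distribʳ _ (f i) (f' i))) (Σ-+ (suc N) _ _)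

  ⋆-distribˡ : ∀ f g g' → (f ⋆ (g ⊕ g')) ≈ₛ ((f ⋆ g) ⊕ (f ⋆ g'))
  ⋆-distribˡ f g g' N = trans (Σ-cong' (suc N) (λ i → distribˡ (f i) _ _)) (Σ-+ (suc N) _ _)

  ⋆-scal : ∀ k k' f g → ((k · f) ⋆ (k' · g)) ≈ₛ ((k * k') · (f ⋆ g))
  ⋆-scal k k' f g N = trans
    (Σ-cong' (suc N) (λ i → solve 4 (λ k k' x y → (k :* x) :* (k' :* y) := (k :* k') :* (x :* y))
                                   refl k k' (f i) (g (N ℕ.∸ i))))
    (Σ-* (suc N) (k * k') _)

  ⋆-zeroˡ : ∀ g → (0ₛ ⋆ g) ≈ₛ 0ₛ
  ⋆-zeroˡ g N = Σ-zero (suc N) (λ i _ → zeroˡ _)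

  ⋆-zeroʳ : ∀ f → (f ⋆ 0ₛ) ≈ₛ 0ₛ
  ⋆-zeroʳ f N = Σ-zero (suc N) (λ i _ → zeroʳ _)

  δ-⋆ : ∀ g → (δ ⋆ g) ≈ₛ g
  δ-⋆ g N = begin
    Σ< (suc N) (λ i → δ i * g (N ℕ.∸ i))          ≈⟨ Σ-first N _ ⟩
    1# * g N + Σ< N (λ i → 0# * g (N ℕ.∸ suc i)) ≈⟨ +-cong (*-identityˡ _) (Σ-zero N (λ i _ → zeroˡ _)) ⟩
    g N + 0#                                       ≈⟨ +-identityʳ _ ⟩
    g N                                            ∎

  ⋆-δ : ∀ f → (f ⋆ δ) ≈ₛ f
  ⋆-δ f N = begin
    Σ< N (λ i → f i * δ (N ℕ.∸ i)) + f N * δ (N ℕ.∸ N)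
      ≈⟨ +-cong (Σ-zero N (λ i i<N → trans (*-congˡ (reflexive (δ-pos N i i<N))) (zeroʳ _)))
                (*-congˡ (reflexive (P.cong δ (ℕP.n∸n≡0 N)))) ⟩
    0# + f N * 1# ≈⟨ trans (+-identityˡ _) (*-identityʳ _) ⟩
    f N           ∎
    where
    δ-pos : ∀ N i → i ℕ.< N → δ (N ℕ.∸ i) ≡ 0#
    δ-pos (suc N) zero    _              = P.refl
    δ-pos (suc N) (suc i) (ℕ.s≤s i<N) = δ-pos N i i<N

  -- The letters as operators on series.  Bop f is t/(1-t)·f, the sequence of
  -- partial sums; Aop multiplies the t^N-coefficient by ϖ(N) = q^N/[N] = F_1̂(N)
  -- and kills the constant term.

  ϖ : ℕ → Carrier
  ϖ = F hat

  Bop : Series → Series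
  Bop f N = Σ< N f

  Aop : Series → Series
  Aop f zero    = 0#
  Aop f (suc N) = ϖ (suc N) * f (suc N)

  letter : AB → Series → Series
  letter a = Aop
  letter b = Bop

  act : Word → Series → Series
  act []      f = f
  act (x ∷ w) f = letter x (act w f)

  act-++ : ∀ u v f → act (u ++ v) f ≡ act u (act v f)
  act-++ []      v f = P.refl
  act-++ (x ∷ u) v f = P.cong (letter x) (act-++ u v f)

  letter-cong : ∀ x {f g} → f ≈ₛ g → letter x f ≈ₛ letter x g
  letter-cong a f≈g zero    = refl
  letter-cong a f≈g (suc N) = *-congˡ (f≈g (suc N))
  letter-cong b f≈g N       = Σ-cong' N f≈g

  letter-⊕ : ∀ x f g → letter x (f ⊕ g) ≈ₛ (letter x f ⊕ letter x g)
  letter-⊕ a f g zero    = sym (+-identityˡ 0#)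
  letter-⊕ a f g (suc N) = distribˡ _ _ _
  letter-⊕ b f g N       = Σ-+ N f g

  letter-· : ∀ x k f → letter x (k · f) ≈ₛ (k · letter x f)
  letter-· a k f zero    = sym (zeroʳ k)
  letter-· a k f (suc N) = solve 3 (λ x y z → x :* (y :* z) := y :* (x :* z)) refl _ k _
  letter-· b k f N       = Σ-* N k f

  letter-0 : ∀ x → letter x 0ₛ ≈ₛ 0ₛ
  letter-0 a zero    = refl
  letter-0 a (suc N) = zeroʳ _
  letter-0 b N       = Σ-zero N (λ _ _ → refl)

  act-cong : ∀ u {f g} → f ≈ₛ g → act u f ≈ₛ act u g
  act-cong []      f≈g = f≈g
  act-cong (x ∷ u) f≈g = letter-cong x (act-cong u f≈g)

  act-⊕ : ∀ u f g → act u (f ⊕ g) ≈ₛ (act u f ⊕ act u g)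
  act-⊕ []      f g = ≈ₛ-refl
  act-⊕ (x ∷ u) f g = ≈ₛ-trans (letter-cong x (act-⊕ u f g)) (letter-⊕ x _ _)

  act-· : ∀ u k f → act u (k · f) ≈ₛ (k · act u f)
  act-· []      k f = ≈ₛ-refl
  act-· (x ∷ u) k f = ≈ₛ-trans (letter-cong x (act-· u k f)) (letter-· x k _)

  act-0 : ∀ u → act u 0ₛ ≈ₛ 0ₛ
  act-0 []      = ≈ₛ-refl
  act-0 (x ∷ u) = ≈ₛ-trans (letter-cong x (act-0 u)) (letter-0 x)

  Bop-⋆ : ∀ f g → (Bop f ⋆ g) ≈ₛ Bop (f ⋆ g)
  Bop-⋆ f g zero    = trans (+-identityˡ _) (zeroˡ _)
  Bop-⋆ f g (suc N) = begin
    (Bop f ⋆ g) (suc N)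
      ≈⟨ Σ-first (suc N) _ ⟩
    0# * g (suc N) + Σ< (suc N) (λ i → (Bop f i + f i) * g (N ℕ.∸ i))
      ≈⟨ +-cong (zeroˡ _) (Σ-cong' (suc N) (λ i → distribʳ _ _ _)) ⟩
    0# + Σ< (suc N) (λ i → Bop f i * g (N ℕ.∸ i) + f i * g (N ℕ.∸ i))
      ≈⟨ trans (+-identityˡ _) (Σ-+ (suc N) _ _) ⟩
    (Bop f ⋆ g) N + (f ⋆ g) N
      ≈⟨ +-congʳ (Bop-⋆ f g N) ⟩
    Bop (f ⋆ g) (suc N) ∎

  ⋆-Bop : ∀ f g → (f ⋆ Bop g) ≈ₛ Bop (f ⋆ g)
  ⋆-Bop f g zero    = trans (+-identityˡ _) (zeroʳ _)
  ⋆-Bop f g (suc N) = begin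
    Σ< (suc N) (λ i → f i * Bop g (suc N ℕ.∸ i)) + f (suc N) * Bop g (N ℕ.∸ N)
      ≈⟨ +-cong (Σ-cong (suc N) split)
                (trans (*-congˡ (reflexive (P.cong (Bop g) (ℕP.n∸n≡0 N)))) (zeroʳ _)) ⟩
    Σ< (suc N) (λ i → f i * Bop g (N ℕ.∸ i) + f i * g (N ℕ.∸ i)) + 0#
      ≈⟨ trans (+-identityʳ _) (Σ-+ (suc N) _ _) ⟩
    (f ⋆ Bop g) N + (f ⋆ g) N
      ≈⟨ +-congʳ (⋆-Bop f g N) ⟩
    Bop (f ⋆ g) (suc N) ∎
    where
    split : ∀ i → i ℕ.< suc N →
            f i * Bop g (suc N ℕ.∸ i) ≈ f i * Bop g (N ℕ.∸ i) + f i * g (N ℕ.∸ i)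
    split i (ℕ.s≤s i≤N) =
      trans (*-congˡ (reflexive (P.cong (Bop g) (ℕP.+-∸-assoc 1 i≤N)))) (distribˡ _ _ _)

  ℏ : Carrier
  ℏ = 1# - q

  S : Word → Series
  S w = act w δ

  W : List (ℕ × Word) → Series
  W []            N = 0#
  W ((j , v) ∷ l) N = ℏ ^ j * S v N + W l N

  S-nonempty-0 : ∀ x w → S (x ∷ w) 0 ≈ 0#
  S-nonempty-0 a w = refl
  S-nonempty-0 b w = refl

  W-++ : ∀ l l' → W (l ++ l') ≈ₛ (W l ⊕ W l')
  W-++ []            l' N = sym (+-identityˡ _)
  W-++ ((j , v) ∷ l) l' N = trans (+-congˡ (W-++ l l' N)) (sym (+-assoc _ _ _))

  -- Prefixing every word with a letter x applies the operator of x.  (Stated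
  -- for any g acting as the prefixing map, since shw uses a private one.)
  W-prefix : ∀ x (g : ℕ × Word → ℕ × Word) → (∀ j v → g (j , v) ≡ (j , x ∷ v)) →
             ∀ l → W (map g l) ≈ₛ letter x (W l)
  W-prefix x g g≡ []            = ≈ₛ-sym (letter-0 x)
  W-prefix x g g≡ ((j , v) ∷ l) N rewrite g≡ j v = begin
    ℏ ^ j * letter x (S v) N + W (map g l) N
      ≈⟨ +-cong (sym (letter-· x (ℏ ^ j) (S v) N)) (W-prefix x g g≡ l N) ⟩
    letter x (ℏ ^ j · S v) N + letter x (W l) N
      ≈⟨ sym (letter-⊕ x _ _ N) ⟩
    letter x (W ((j , v) ∷ l)) N ∎

  W-weight : ∀ (g : ℕ × Word → ℕ × Word) → (∀ j v → g (j , v) ≡ (suc j , v)) →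
             ∀ l → W (map g l) ≈ₛ (ℏ · W l)
  W-weight g g≡ []            N = sym (zeroʳ _)
  W-weight g g≡ ((j , v) ∷ l) N rewrite g≡ j v =
    trans (+-cong (*-assoc _ _ _) (W-weight g g≡ l N)) (sym (distribˡ _ _ _))

  W-single : ∀ v → W [ (0 , v) ] ≈ₛ S v
  W-single v N = trans (+-identityʳ _) (*-identityˡ _)

  pow-+ : ∀ x i j → x ^ (i ℕ.+ j) ≈ x ^ i * x ^ j
  pow-+ x zero    j = sym (*-identityˡ _)
  pow-+ x (suc i) j = trans (*-congˡ (pow-+ x i j)) (sym (*-assoc _ _ _))

  pow-* : ∀ x y n → (x * y) ^ n ≈ x ^ n * y ^ n
  pow-* x y zero    = sym (*-identityˡ 1#)
  pow-* x y (suc n) = trans (*-congˡ (pow-* x y n))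
    (solve 4 (λ x y z w → (x :* y) :* (z :* w) := (x :* z) :* (y :* w)) refl _ _ _ _)

  pow-pow : ∀ x M n → (x ^ M) ^ n ≈ x ^ (n ℕ.* M)
  pow-pow x M zero    = refl
  pow-pow x M (suc n) = trans (*-congˡ (pow-pow x M n)) (sym (pow-+ x M (n ℕ.* M)))

  q+ℏ≈1 : q + ℏ ≈ 1#
  q+ℏ≈1 = begin
    q + (1# - q)      ≈⟨ +-congˡ (+-comm 1# (- q)) ⟩
    q + (- q + 1#)    ≈⟨ sym (+-assoc _ _ _) ⟩
    (q + - q) + 1#    ≈⟨ +-congʳ (-‿inverseʳ q) ⟩
    0# + 1#           ≈⟨ +-identityˡ 1# ⟩
    1#                ∎

  q-telescope : ∀ m → q ^ m + ℏ * qint m ≈ 1#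
  q-telescope zero    = trans (+-congˡ (zeroʳ ℏ)) (+-identityʳ 1#)
  q-telescope (suc m) = begin
    q * q ^ m + ℏ * (qint m + q ^ m)
      ≈⟨ solve 4 (λ Q x y h → Q :* x :+ h :* (y :+ x) := (Q :+ h) :* x :+ h :* y) refl q (q ^ m) (qint m) ℏ ⟩
    (q + ℏ) * q ^ m + ℏ * qint m
      ≈⟨ +-congʳ (trans (*-congʳ q+ℏ≈1) (*-identityˡ _)) ⟩
    q ^ m + ℏ * qint m
      ≈⟨ q-telescope m ⟩
    1# ∎

  qint-+ : ∀ i j → qint (i ℕ.+ j) ≈ qint i + q ^ i * qint j
  qint-+ i zero    = trans (reflexive (P.cong qint (ℕP.+-identityʳ i)))
                           (sym (trans (+-congˡ (zeroʳ _)) (+-identityʳ _)))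
  qint-+ i (suc j) = begin
    qint (i ℕ.+ suc j)                          ≈⟨ reflexive (P.cong qint (ℕP.+-suc i j)) ⟩
    qint (i ℕ.+ j) + q ^ (i ℕ.+ j)              ≈⟨ +-cong (qint-+ i j) (pow-+ q i j) ⟩
    (qint i + q ^ i * qint j) + q ^ i * q ^ j   ≈⟨ solve 4 (λ A x B y → (A :+ x :* B) :+ x :* y := A :+ x :* (B :+ y))
                                                            refl (qint i) (q ^ i) (qint j) (q ^ j) ⟩
    qint i + q ^ i * (qint j + q ^ j)           ∎

  module WithQInverses (qint-inv : ∀ (m : ℕ) → qint (suc m) * inv (suc m) ≈ 1#) where

    ϖ+ℏ : ∀ m → ϖ (suc m) + ℏ ≈ inv (suc m)
    ϖ+ℏ m = begin
      x * I + ℏ             ≈⟨ +-congˡ (sym (trans (*-congˡ (qint-inv m)) (*-identityʳ ℏ))) ⟩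
      x * I + ℏ * (Q * I)   ≈⟨ solve 4 (λ x I h Q → x :* I :+ h :* (Q :* I) := (x :+ h :* Q) :* I) refl x I ℏ Q ⟩
      (x + ℏ * Q) * I       ≈⟨ trans (*-congʳ (q-telescope (suc m))) (*-identityˡ I) ⟩
      I                     ∎
      where
      x = q ^ suc m
      I = inv (suc m)
      Q = qint (suc m)

    -- 1/([i+j]) · (ϖ(i) + ϖ(j) + ℏ) = 1/([i][j]), clearing denominators with
    -- [i+j] = q^i[j] + [i](q^j + ℏ[j]).
    inv-sum : ∀ i j → inv (suc i ℕ.+ suc j) * (ϖ (suc i) + ϖ (suc j) + ℏ) ≈ inv (suc i) * inv (suc j)
    inv-sum i j = begin
      K * (x * I + y * J + ℏ)
        ≈⟨ sym (trans (*-congˡ (*-cong (qint-inv i) (qint-inv j))) (trans (*-congˡ (*-identityˡ 1#)) (*-identityʳ _))) ⟩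
      K * (x * I + y * J + ℏ) * ((Qi * I) * (Qj * J))
        ≈⟨ solve 8 (λ K I J x y h Qi Qj → K :* (x :* I :+ y :* J :+ h) :* ((Qi :* I) :* (Qj :* J))
                      := (K :* I :* J) :* (x :* Qj :* (Qi :* I) :+ Qi :* (y :* (Qj :* J) :+ h :* Qj)))
                   refl K I J x y ℏ Qi Qj ⟩
      (K * I * J) * (x * Qj * (Qi * I) + Qi * (y * (Qj * J) + ℏ * Qj))
        ≈⟨ *-congˡ (+-cong (trans (*-congˡ (qint-inv i)) (*-identityʳ _))
                           (trans (*-congˡ (trans (+-congʳ (trans (*-congˡ (qint-inv j)) (*-identityʳ _)))
                                                  (q-telescope (suc j))))
                                  (*-identityʳ _))) ⟩
      (K * I * J) * (x * Qj + Qi)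
        ≈⟨ *-congˡ (trans (+-comm _ _) (sym (qint-+ (suc i) (suc j)))) ⟩
      (K * I * J) * Qk
        ≈⟨ solve 4 (λ K I J Q → (K :* I :* J) :* Q := (I :* J) :* (Q :* K)) refl K I J Qk ⟩
      (I * J) * (Qk * K)
        ≈⟨ trans (*-congˡ (qint-inv (i ℕ.+ suc j))) (*-identityʳ _) ⟩
      I * J ∎
      where
      K = inv (suc i ℕ.+ suc j)
      I = inv (suc i)
      J = inv (suc j)
      x = q ^ suc i
      y = q ^ suc j
      Qi = qint (suc i)
      Qj = qint (suc j)
      Qk = qint (suc i ℕ.+ suc j)

    -- The q-analogue of 1/(ij) = 1/(i+j) · (1/i + 1/j).
    ϖ-product : ∀ i j → ϖ (suc i) * ϖ (suc j) ≈ ϖ (suc i ℕ.+ suc j) * (ϖ (suc i) + ϖ (suc j) + ℏ)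
    ϖ-product i j = begin
      (x * I) * (y * J)   ≈⟨ solve 4 (λ x I y J → (x :* I) :* (y :* J) := (x :* y) :* (I :* J)) refl x I y J ⟩
      (x * y) * (I * J)   ≈⟨ *-congˡ (sym (inv-sum i j)) ⟩
      (x * y) * (K * E)   ≈⟨ sym (trans (*-assoc _ _ _) (*-congʳ (pow-+ q (suc i) (suc j)))) ⟩
      (q ^ (suc i ℕ.+ suc j) * K) * E ∎
      where
      K = inv (suc i ℕ.+ suc j)
      I = inv (suc i)
      J = inv (suc j)
      x = q ^ suc i
      y = q ^ suc j
      E = ϖ (suc i) + ϖ (suc j) + ℏ

    Aop-summand : ∀ (f g : Series) → f 0 ≈ 0# → g 0 ≈ 0# → ∀ i j N → i ℕ.+ j ≡ N →
      Aop f i * Aop g j ≈ ϖ N * (Aop f i * g j + (f i * Aop g j + ℏ * (f i * g j)))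
    Aop-summand f g f0≈0 g0≈0 zero j N _ = begin
      0# * Aop g j  ≈⟨ zeroˡ _ ⟩
      0#            ≈⟨ sym (zeroʳ _) ⟩
      ϖ N * 0#      ≈⟨ *-congˡ (sym (trans (+-cong (zeroˡ _) (+-cong f0*≈0 (trans (*-congˡ f0*≈0) (zeroʳ _))))
                                           (trans (+-identityˡ _) (+-identityˡ _)))) ⟩
      ϖ N * (0# * g j + (f 0 * Aop g j + ℏ * (f 0 * g j))) ∎
      where
      f0*≈0 : ∀ {x} → f 0 * x ≈ 0#
      f0*≈0 = trans (*-congʳ f0≈0) (zeroˡ _)
    Aop-summand f g f0≈0 g0≈0 (suc i) zero N _ = begin
      Aop f (suc i) * 0#  ≈⟨ zeroʳ _ ⟩
      0#                  ≈⟨ sym (zeroʳ _) ⟩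
      ϖ N * 0#            ≈⟨ *-congˡ (sym (trans (+-cong *g0≈0 (+-cong (zeroʳ _) (trans (*-congˡ *g0≈0) (zeroʳ _))))
                                                 (trans (+-identityˡ _) (+-identityˡ _)))) ⟩
      ϖ N * (Aop f (suc i) * g 0 + (f (suc i) * 0# + ℏ * (f (suc i) * g 0))) ∎
      where
      *g0≈0 : ∀ {x} → x * g 0 ≈ 0#
      *g0≈0 = trans (*-congˡ g0≈0) (zeroʳ _)
    Aop-summand f g _ _ (suc i) (suc j) N P.refl = begin
      (ϖi * fi) * (ϖj * gj)
        ≈⟨ solve 4 (λ a b x y → (a :* x) :* (b :* y) := (a :* b) :* (x :* y)) refl ϖi ϖj fi gj ⟩
      (ϖi * ϖj) * (fi * gj)
        ≈⟨ *-congʳ (ϖ-product i j) ⟩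
      (ϖN * (ϖi + ϖj + ℏ)) * (fi * gj)
        ≈⟨ solve 6 (λ n a b h x y → (n :* (a :+ b :+ h)) :* (x :* y) := n :* ((a :* x) :* y :+ (x :* (b :* y) :+ h :* (x :* y))))
                   refl ϖN ϖi ϖj ℏ fi gj ⟩
      ϖN * ((ϖi * fi) * gj + (fi * (ϖj * gj) + ℏ * (fi * gj))) ∎
      where
      ϖi = ϖ (suc i)
      ϖj = ϖ (suc j)
      ϖN = ϖ (suc i ℕ.+ suc j)
      fi = f (suc i)
      gj = g (suc j)

    -- Product rule for a, mirroring the clause  aw ⧢ aw' = a(aw ⧢ w' + w ⧢ aw' + ℏ w ⧢ w').
    Aop-⋆ : ∀ (f g : Series) → f 0 ≈ 0# → g 0 ≈ 0# →
      (Aop f ⋆ Aop g) ≈ₛ Aop ((Aop f ⋆ g) ⊕ ((f ⋆ Aop g) ⊕ (ℏ · (f ⋆ g))))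
    Aop-⋆ f g f0≈0 g0≈0 zero    = trans (+-identityˡ _) (zeroˡ _)
    Aop-⋆ f g f0≈0 g0≈0 (suc M) = begin
      Σ< (suc (suc M)) (λ i → Aop f i * Aop g (suc M ℕ.∸ i))
        ≈⟨ Σ-cong (suc (suc M)) (λ i i≤ → Aop-summand f g f0≈0 g0≈0 i (suc M ℕ.∸ i) (suc M)
                                             (ℕP.m+[n∸m]≡n (ℕP.≤-pred i≤))) ⟩
      Σ< (suc (suc M)) (λ i → ϖ (suc M) * summand i)
        ≈⟨ Σ-* (suc (suc M)) _ _ ⟩
      ϖ (suc M) * Σ< (suc (suc M)) summand
        ≈⟨ *-congˡ (trans (Σ-+ (suc (suc M)) _ _)
                          (+-congˡ (trans (Σ-+ (suc (suc M)) _ _) (+-congˡ (Σ-* (suc (suc M)) _ _))))) ⟩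
      ϖ (suc M) * ((Aop f ⋆ g) (suc M) + ((f ⋆ Aop g) (suc M) + ℏ * (f ⋆ g) (suc M))) ∎
      where
      summand : ℕ → Carrier
      summand i = Aop f i * g (suc M ℕ.∸ i)
                + (f i * Aop g (suc M ℕ.∸ i) + ℏ * (f i * g (suc M ℕ.∸ i)))

    shuffle : ∀ u v → Admissible u → Admissible v → W (shw u v) ≈ₛ (S u ⋆ S v)
    shuffle [] v _ _ = ≈ₛ-trans (W-single v) (≈ₛ-sym (δ-⋆ (S v)))
    shuffle (b ∷ u) v (b∷ adm-u) adm-v =
      ≈ₛ-trans (W-prefix b _ (λ _ _ → P.refl) (shw u v))
        (≈ₛ-trans (letter-cong b (shuffle u v adm-u adm-v)) (≈ₛ-sym (Bop-⋆ (S u) (S v))))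
    shuffle (a ∷ x ∷ u) [] _ _ = ≈ₛ-trans (W-single (a ∷ x ∷ u)) (≈ₛ-sym (⋆-δ (S (a ∷ x ∷ u))))
    shuffle (a ∷ x ∷ u) (b ∷ v) adm-u (b∷ adm-v) =
      ≈ₛ-trans (W-prefix b _ (λ _ _ → P.refl) (shw (a ∷ x ∷ u) v))
        (≈ₛ-trans (letter-cong b (shuffle (a ∷ x ∷ u) v adm-u adm-v)) (≈ₛ-sym (⋆-Bop (S (a ∷ x ∷ u)) (S v))))
    shuffle (a ∷ x ∷ u) (a ∷ y ∷ v) (a∷ adm-u) (a∷ adm-v) =
      ≈ₛ-trans (W-prefix a _ (λ _ _ → P.refl) (l₁ ++ (l₂ ++ map _ l₃)))
        (≈ₛ-trans (letter-cong a
          (≈ₛ-trans (W-++ l₁ _) (⊕-cong (shuffle (a ∷ x ∷ u) (y ∷ v) (a∷ adm-u) adm-v)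
            (≈ₛ-trans (W-++ l₂ _) (⊕-cong (shuffle (x ∷ u) (a ∷ y ∷ v) adm-u (a∷ adm-v))
              (≈ₛ-trans (W-weight _ (λ _ _ → P.refl) l₃)
                        (λ N → *-congˡ (shuffle (x ∷ u) (y ∷ v) adm-u adm-v N))))))))
          (≈ₛ-sym (Aop-⋆ (S (x ∷ u)) (S (y ∷ v)) (S-nonempty-0 x u) (S-nonempty-0 y v))))
      where
      l₁ = shw (a ∷ x ∷ u) (y ∷ v)
      l₂ = shw (x ∷ u) (a ∷ y ∷ v)
      l₃ = shw (x ∷ u) (y ∷ v)

    H-partialSum : ∀ ks N → H ks (suc N) ≈ Bop (Lw ks) (suc N)
    H-partialSum []       N = sym (Σ-1 N)
      where
      Σ-1 : ∀ N → Σ< (suc N) (Lw []) ≈ 1#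
      Σ-1 zero    = +-identityˡ 1#
      Σ-1 (suc N) = trans (+-identityʳ _) (Σ-1 N)
    H-partialSum (k ∷ ks) N = Σ-cong' (suc N) (λ { zero → refl ; (suc m) → refl })

    Lw-hat : ∀ ks → Lw (hat ∷ ks) ≈ₛ act (a ∷ b ∷ []) (Lw ks)
    Lw-hat ks zero    = refl
    Lw-hat ks (suc N) = *-congˡ (H-partialSum ks N)

    -- F_k(m) = ϖ(m)^k + ℏϖ(m)^{k-1}, from ϖ(m) + ℏ = 1/[m].
    F-pos : ∀ k m → q ^ (k ℕ.* suc m) * inv (suc m) ^ suc k ≈ ϖ (suc m) ^ suc k + ℏ * ϖ (suc m) ^ k
    F-pos k m = sym (begin
      ϖm * ϖm ^ k + ℏ * ϖm ^ k   ≈⟨ sym (distribʳ _ _ _) ⟩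
      (ϖm + ℏ) * ϖm ^ k          ≈⟨ *-cong (ϖ+ℏ m) (trans (pow-* _ _ k) (*-congʳ (pow-pow q (suc m) k))) ⟩
      I * (q ^ (k ℕ.* suc m) * I ^ k) ≈⟨ solve 3 (λ x y z → x :* (y :* z) := y :* (x :* z)) refl _ _ _ ⟩
      q ^ (k ℕ.* suc m) * (I * I ^ k) ∎)
      where
      ϖm = ϖ (suc m)
      I = inv (suc m)

    Aᵏ-at : ∀ k f N → act (replicate k a) f (suc N) ≈ ϖ (suc N) ^ k * f (suc N)
    Aᵏ-at zero    f N = sym (*-identityˡ _)
    Aᵏ-at (suc k) f N = trans (*-congˡ (Aᵏ-at k f N)) (sym (*-assoc _ _ _))

    aᵏb-at : ∀ k f N → act (replicate k a ++ [ b ]) f (suc N) ≈ ϖ (suc N) ^ k * Bop f (suc N)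
    aᵏb-at k f N = trans (reflexive (P.cong (λ h → h (suc N)) (act-++ (replicate k a) [ b ] f))) (Aᵏ-at k (Bop f) N)

    aᵏb-at-0 : ∀ k f → act (replicate k a ++ [ b ]) f 0 ≈ 0#
    aᵏb-at-0 zero    f = refl
    aᵏb-at-0 (suc k) f = refl

    Lw-pos : ∀ k (k≥1 : 1 ℕ.≤ k) ks →
      Lw (pos k k≥1 ∷ ks) ≈ₛ (act (replicate k a ++ [ b ]) (Lw ks) ⊕ (ℏ · act (replicate (k ℕ.∸ 1) a ++ [ b ]) (Lw ks)))
    Lw-pos (suc k) _ ks zero    = sym (trans (+-congˡ (trans (*-congˡ (aᵏb-at-0 k (Lw ks))) (zeroʳ ℏ)))
                                             (+-identityˡ 0#))
    Lw-pos (suc k) _ ks (suc N) = begin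
      q ^ (k ℕ.* suc N) * inv (suc N) ^ suc k * H ks (suc N)
        ≈⟨ *-cong (F-pos k N) (H-partialSum ks N) ⟩
      (ϖN ^ suc k + ℏ * ϖN ^ k) * BL
        ≈⟨ solve 4 (λ x h y B → (x :+ h :* y) :* B := x :* B :+ h :* (y :* B)) refl _ ℏ _ BL ⟩
      ϖN ^ suc k * BL + ℏ * (ϖN ^ k * BL)
        ≈⟨ sym (+-cong (aᵏb-at (suc k) (Lw ks) N) (*-congˡ (aᵏb-at k (Lw ks) N))) ⟩
      (act (replicate (suc k) a ++ [ b ]) (Lw ks) ⊕ (ℏ · act (replicate k a ++ [ b ]) (Lw ks))) (suc N) ∎
      where
      ϖN = ϖ (suc N)
      BL = Bop (Lw ks) (suc N)

    module Linear (φ-+ : ∀ x y → φ (x ℚ.+ y) ≈ φ x + φ y) (φ-* : ∀ x y → φ (x ℚ.* y) ≈ φ x * φ y)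
                  (φ-0 : φ ℚ.0ℚ ≈ 0#) (φ-1 : φ ℚ.1ℚ ≈ 1#)
                  (ℏ*hinv≈1 : ℏ * hinv ≈ 1#) where

      hpow-suc : ∀ z → hpow (ℤ.suc z) ≈ ℏ * hpow z
      hpow-suc (+ n)            = refl
      hpow-suc -[1+ zero ]      = sym (trans (*-congˡ (*-identityʳ hinv)) ℏ*hinv≈1)
      hpow-suc -[1+ suc n ]     = sym (trans (sym (*-assoc _ _ _)) (trans (*-congʳ ℏ*hinv≈1) (*-identityˡ _)))

      hpow-pred : ∀ z → hpow (ℤ.pred z) ≈ hinv * hpow z
      hpow-pred (+ zero)    = refl
      hpow-pred (+ suc n)   = sym (trans (sym (*-assoc _ _ _)) (trans (*-congʳ (trans (*-comm _ _) ℏ*hinv≈1)) (*-identityˡ _)))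
      hpow-pred -[1+ n ]    = refl

      hpow-+ : ∀ x y → hpow (x ℤ.+ y) ≈ hpow x * hpow y
      hpow-+ (+ zero)      y = trans (reflexive (P.cong hpow (ℤP.+-identityˡ y))) (sym (*-identityˡ _))
      hpow-+ (+ suc n)     y = begin
        hpow (+ suc n ℤ.+ y)        ≈⟨ reflexive (P.cong hpow (ℤP.+-assoc (+ 1) (+ n) y)) ⟩
        hpow (ℤ.suc (+ n ℤ.+ y))    ≈⟨ hpow-suc (+ n ℤ.+ y) ⟩
        ℏ * hpow (+ n ℤ.+ y)        ≈⟨ *-congˡ (hpow-+ (+ n) y) ⟩
        ℏ * (hpow (+ n) * hpow y)   ≈⟨ sym (*-assoc _ _ _) ⟩
        hpow (+ suc n) * hpow y     ∎
      hpow-+ -[1+ zero ]   y = trans (hpow-pred y) (*-congʳ (sym (*-identityʳ hinv)))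
      hpow-+ -[1+ suc n ]  y = begin
        hpow (-[1+ suc n ] ℤ.+ y)         ≈⟨ reflexive (P.cong hpow (ℤP.+-assoc -[1+ 0 ] -[1+ n ] y)) ⟩
        hpow (ℤ.pred (-[1+ n ] ℤ.+ y))    ≈⟨ hpow-pred (-[1+ n ] ℤ.+ y) ⟩
        hinv * hpow (-[1+ n ] ℤ.+ y)      ≈⟨ *-congˡ (hpow-+ -[1+ n ] y) ⟩
        hinv * (hpow -[1+ n ] * hpow y)   ≈⟨ sym (*-assoc _ _ _) ⟩
        hpow -[1+ suc n ] * hpow y        ∎

      scalar : ℚ → ℤ → Carrier
      scalar c m = φ c * hpow m

      scalar-* : ∀ c m c' m' → scalar (c ℚ.* c') (m ℤ.+ m') ≈ scalar c m * scalar c' m'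
      scalar-* c m c' m' = trans (*-cong (φ-* c c') (hpow-+ m m'))
        (solve 4 (λ x y z w → (x :* y) :* (z :* w) := (x :* z) :* (y :* w)) refl _ _ _ _)

      Λₜ : Term → Series
      Λₜ (c , m , v) = scalar c m · S v

      Λ : Poly → Series
      Λ []      N = 0#
      Λ (t ∷ p) N = Λₜ t N + Λ p N

      Λ-++ : ∀ p p' → Λ (p ++ p') ≈ₛ (Λ p ⊕ Λ p')
      Λ-++ []      p' N = sym (+-identityˡ _)
      Λ-++ (t ∷ p) p' N = trans (+-congˡ (Λ-++ p p' N)) (sym (+-assoc _ _ _))

      Λ-prefix : ∀ (g : Term → Term) c n u → (∀ c' n' w → g (c' , n' , w) ≡ (c ℚ.* c' , n ℤ.+ n' , u ++ w)) →
                 ∀ l → Λ (map g l) ≈ₛ (scalar c n · act u (Λ l))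
      Λ-prefix g c n u g≡ []                  N = sym (trans (*-congˡ (act-0 u N)) (zeroʳ _))
      Λ-prefix g c n u g≡ ((c' , n' , w) ∷ l) N rewrite g≡ c' n' w = begin
        scalar (c ℚ.* c') (n ℤ.+ n') * S (u ++ w) N + Λ (map g l) N
          ≈⟨ +-cong (*-cong (scalar-* c n c' n') (reflexive (P.cong (λ h → h N) (act-++ u w δ))))
                    (Λ-prefix g c n u g≡ l N) ⟩
        (k * k') * act u (S w) N + k * act u (Λ l) N
          ≈⟨ +-congʳ (trans (*-assoc _ _ _) (*-congˡ (sym (act-· u k' (S w) N)))) ⟩
        k * act u (k' · S w) N + k * act u (Λ l) N
          ≈⟨ sym (trans (*-congˡ (act-⊕ u _ _ N)) (distribˡ _ _ _)) ⟩
        k * act u (Λ ((c' , n' , w) ∷ l)) N ∎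
        where
        k  = scalar c n
        k' = scalar c' n'

      Λ-shuffleTerm : ∀ (g : ℕ × Word → Term) c n u c' n' u' →
        (∀ j v → g (j , v) ≡ (c ℚ.* c' , n ℤ.+ n' ℤ.+ + j , v)) →
        Admissible u → Admissible u' → Λ (map g (shw u u')) ≈ₛ (Λₜ (c , n , u) ⋆ Λₜ (c' , n' , u'))
      Λ-shuffleTerm g c n u c' n' u' g≡ adm-u adm-u' N = begin
        Λ (map g (shw u u')) N         ≈⟨ weighted (shw u u') ⟩
        k * W (shw u u') N             ≈⟨ *-cong (scalar-* c n c' n') (shuffle u u' adm-u adm-u' N) ⟩
        (scalar c n * scalar c' n') * (S u ⋆ S u') N ≈⟨ sym (⋆-scal _ _ (S u) (S u') N) ⟩
        (Λₜ (c , n , u) ⋆ Λₜ (c' , n' , u')) N ∎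
        where
        k = scalar (c ℚ.* c') (n ℤ.+ n')
        weighted : ∀ l → Λ (map g l) N ≈ k * W l N
        weighted []            = sym (zeroʳ _)
        weighted ((j , v) ∷ l) rewrite g≡ j v = begin
          scalar (c ℚ.* c') (n ℤ.+ n' ℤ.+ + j) * S v N + Λ (map g l) N
            ≈⟨ +-cong (*-congʳ (trans (*-congˡ (hpow-+ (n ℤ.+ n') (+ j))) (sym (*-assoc _ _ _)))) (weighted l) ⟩
          k * ℏ ^ j * S v N + k * W l N
            ≈⟨ trans (+-congʳ (*-assoc _ _ _)) (sym (distribˡ _ _ _)) ⟩
          k * W ((j , v) ∷ l) N ∎

      Λ-bilinear : (_◇_ : Term → Term → Poly) →
        (∀ c n u c' n' u' → Admissible u → Admissible u' →
           Λ ((c , n , u) ◇ (c' , n' , u')) ≈ₛ (Λₜ (c , n , u) ⋆ Λₜ (c' , n' , u'))) →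
        ∀ p p' → Admissibles p → Admissibles p' →
        Λ (concatMap (λ t → concatMap (λ t' → t ◇ t') p') p) ≈ₛ (Λ p ⋆ Λ p')
      Λ-bilinear _◇_ ◇-mult p p' adm adm' = outer p adm
        where
        inner : ∀ c n u → Admissible u → ∀ p' → Admissibles p' →
                Λ (concatMap ((c , n , u) ◇_) p') ≈ₛ (Λₜ (c , n , u) ⋆ Λ p')
        inner c n u adm-u []                  _                = ≈ₛ-sym (⋆-zeroʳ (Λₜ (c , n , u)))
        inner c n u adm-u ((c' , n' , u') ∷ p') (adm-u' ∷ adm') =
          ≈ₛ-trans (Λ-++ ((c , n , u) ◇ (c' , n' , u')) _)
            (≈ₛ-trans (⊕-cong (◇-mult c n u c' n' u' adm-u adm-u') (inner c n u adm-u p' adm'))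
                      (≈ₛ-sym (⋆-distribˡ (Λₜ (c , n , u)) (Λₜ (c' , n' , u')) (Λ p'))))

        outer : ∀ p → Admissibles p → Λ (concatMap (λ t → concatMap (t ◇_) p') p) ≈ₛ (Λ p ⋆ Λ p')
        outer []                _                = ≈ₛ-sym (⋆-zeroˡ (Λ p'))
        outer ((c , n , u) ∷ p) (adm-u ∷ adm-p) =
          ≈ₛ-trans (Λ-++ (concatMap ((c , n , u) ◇_) p') _)
            (≈ₛ-trans (⊕-cong (inner c n u adm-u p' adm') (outer p adm-p))
                      (≈ₛ-sym (⋆-distribʳ (Λₜ (c , n , u)) (Λ p) (Λ p'))))

      -- Λ respects equality in 𝔥: over any duplicate-free list K of keys
      -- (v , m) covering the terms of p, Λ p is the sum of the terms
      -- coeff p v m ℏᵐ v, which only depends on the coefficients of p.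

      Key : Set
      Key = Word × ℤ

      _≟K_ : (x y : Key) → Dec (x ≡ y)
      _≟K_ = ×P.≡-dec _≟W_ ℤ._≟_

      keys : Poly → List Key
      keys []                  = []
      keys ((c , m , v) ∷ p) = (v , m) ∷ keys p

      Λ-coeffs : Poly → List Key → Series
      Λ-coeffs p []              N = 0#
      Λ-coeffs p ((v , m) ∷ K) N = Λₜ (coeff p v m , m , v) N + Λ-coeffs p K N

      coeff-hit : ∀ c m v p → coeff ((c , m , v) ∷ p) v m ≡ c ℚ.+ coeff p v m
      coeff-hit c m v p with v ≟W v | m ℤ.≟ m
      ... | yes _  | yes _  = P.refl
      ... | no v≢v | _      = ⊥-elim (v≢v P.refl)
      ... | yes _  | no m≢m = ⊥-elim (m≢m P.refl)

      coeff-miss : ∀ c m v p v' m' → ¬ ((v , m) ≡ (v' , m')) → coeff ((c , m , v) ∷ p) v' m' ≡ coeff p v' m'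
      coeff-miss c m v p v' m' ≢ with v ≟W v' | m ℤ.≟ m'
      ... | yes P.refl | yes P.refl = ⊥-elim (≢ P.refl)
      ... | no _       | _          = P.refl
      ... | yes _      | no _       = P.refl

      Λₜ-coeff-cong : ∀ {c c'} m v → c ≡ c' → Λₜ (c , m , v) ≈ₛ Λₜ (c' , m , v)
      Λₜ-coeff-cong m v P.refl = ≈ₛ-refl

      Λ-coeffs-cong : ∀ p p' → p ≈ₕ p' → ∀ K → Λ-coeffs p K ≈ₛ Λ-coeffs p' K
      Λ-coeffs-cong p p' p≈p' []              N = refl
      Λ-coeffs-cong p p' p≈p' ((v , m) ∷ K) N =
        +-cong (Λₜ-coeff-cong m v (p≈p' v m) N) (Λ-coeffs-cong p p' p≈p' K N)

      Λ-coeffs-miss : ∀ c m v p K → All (λ k → ¬ ((v , m) ≡ k)) K → Λ-coeffs ((c , m , v) ∷ p) K ≈ₛ Λ-coeffs p K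
      Λ-coeffs-miss c m v p []                _              N = refl
      Λ-coeffs-miss c m v p ((v' , m') ∷ K) (≢ ∷ ≢s) N =
        +-cong (Λₜ-coeff-cong m' v' (coeff-miss c m v p v' m' ≢) N) (Λ-coeffs-miss c m v p K ≢s N)

      Λ-coeffs-hit : ∀ c m v p K → Unique K → (v , m) ∈ K →
                     Λ-coeffs ((c , m , v) ∷ p) K ≈ₛ (Λₜ (c , m , v) ⊕ Λ-coeffs p K)
      Λ-coeffs-hit c m v p (_ ∷ K) (≢s ∷ _) (here P.refl) N = begin
        scalar (coeff ((c , m , v) ∷ p) v m) m * S v N + Λ-coeffs ((c , m , v) ∷ p) K N
          ≈⟨ +-cong (*-congʳ (*-congʳ (trans (reflexive (P.cong φ (coeff-hit c m v p))) (φ-+ c _))))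
                    (Λ-coeffs-miss c m v p K ≢s N) ⟩
        ((φ c + φ (coeff p v m)) * hpow m) * S v N + Λ-coeffs p K N
          ≈⟨ +-congʳ (solve 4 (λ x y h s → ((x :+ y) :* h) :* s := (x :* h) :* s :+ (y :* h) :* s) refl _ _ _ _) ⟩
        (Λₜ (c , m , v) N + Λₜ (coeff p v m , m , v) N) + Λ-coeffs p K N
          ≈⟨ +-assoc _ _ _ ⟩
        Λₜ (c , m , v) N + Λ-coeffs p ((v , m) ∷ K) N ∎
      Λ-coeffs-hit c m v p ((v' , m') ∷ K) (≢s ∷ unique) (there i) N = begin
        Λₜ (coeff ((c , m , v) ∷ p) v' m' , m' , v') N + Λ-coeffs ((c , m , v) ∷ p) K N
          ≈⟨ +-cong (Λₜ-coeff-cong m' v' (coeff-miss c m v p v' m' (λ e → All.lookup ≢s i (P.sym e))) N)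
                    (Λ-coeffs-hit c m v p K unique i N) ⟩
        Λₜ (coeff p v' m' , m' , v') N + (Λₜ (c , m , v) N + Λ-coeffs p K N)
          ≈⟨ solve 3 (λ x y z → x :+ (y :+ z) := y :+ (x :+ z)) refl _ _ _ ⟩
        Λₜ (c , m , v) N + Λ-coeffs p ((v' , m') ∷ K) N ∎

      Λ-coeffs-nil : ∀ K → Λ-coeffs [] K ≈ₛ 0ₛ
      Λ-coeffs-nil []              N = refl
      Λ-coeffs-nil ((v , m) ∷ K) N =
        trans (+-cong (trans (*-congʳ (trans (*-congʳ φ-0) (zeroˡ _))) (zeroˡ _)) (Λ-coeffs-nil K N)) (+-identityˡ 0#)

      Λ≈Λ-coeffs : ∀ p K → Unique K → (∀ {k} → k ∈ keys p → k ∈ K) → Λ p ≈ₛ Λ-coeffs p K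
      Λ≈Λ-coeffs []                K _      _    = ≈ₛ-sym (Λ-coeffs-nil K)
      Λ≈Λ-coeffs ((c , m , v) ∷ p) K unique keys⊆ N =
        trans (+-congˡ (Λ≈Λ-coeffs p K unique (keys⊆ ∘ there) N))
              (sym (Λ-coeffs-hit c m v p K unique (keys⊆ (here P.refl)) N))

      Λ-resp : ∀ p p' → p ≈ₕ p' → Λ p ≈ₛ Λ p'
      Λ-resp p p' p≈p' =
        ≈ₛ-trans (Λ≈Λ-coeffs p K unique (λ i → ∈P.∈-deduplicate⁺ _≟K_ (∈P.∈-++⁺ˡ i)))
          (≈ₛ-trans (Λ-coeffs-cong p p' p≈p' K)
            (≈ₛ-sym (Λ≈Λ-coeffs p' K unique (λ i → ∈P.∈-deduplicate⁺ _≟K_ (∈P.∈-++⁺ʳ (keys p) i)))))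
        where
        K = deduplicate _≟K_ (keys p ++ keys p')
        unique = deduplicate-! _≟K_ (keys p ++ keys p')

      scalar-1-0 : scalar ℚ.1ℚ (+ 0) ≈ 1#
      scalar-1-0 = trans (*-identityʳ _) φ-1

      scalar-1-1 : scalar ℚ.1ℚ (+ 1) ≈ ℏ
      scalar-1-1 = trans (*-congʳ φ-1) (trans (*-identityˡ _) (*-identityʳ ℏ))

      Λ-eWord : ∀ ks → Λ (eWord ks) ≈ₛ Lw ks
      Λ-eWord []             zero    = trans (+-identityʳ _) (trans (*-congʳ scalar-1-0) (*-identityˡ 1#))
      Λ-eWord []             (suc N) = trans (+-identityʳ _) (zeroʳ _)
      Λ-eWord (hat ∷ ks)     N = begin
        Λ (map _ (eWord ks) ++ []) N
          ≈⟨ trans (Λ-++ (map _ (eWord ks)) [] N) (+-identityʳ _) ⟩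
        Λ (map _ (eWord ks)) N
          ≈⟨ Λ-prefix _ ℚ.1ℚ (+ 0) (a ∷ b ∷ []) (λ _ _ _ → P.refl) (eWord ks) N ⟩
        scalar ℚ.1ℚ (+ 0) * act (a ∷ b ∷ []) (Λ (eWord ks)) N
          ≈⟨ *-cong scalar-1-0 (act-cong (a ∷ b ∷ []) (Λ-eWord ks) N) ⟩
        1# * act (a ∷ b ∷ []) (Lw ks) N
          ≈⟨ trans (*-identityˡ _) (sym (Lw-hat ks N)) ⟩
        Lw (hat ∷ ks) N ∎
      Λ-eWord (pos (suc k) k≥1 ∷ ks) N = begin
        Λ (map _ (eWord ks) ++ (map _ (eWord ks) ++ [])) N
          ≈⟨ trans (Λ-++ (map _ (eWord ks)) _ N) (+-congˡ (trans (Λ-++ (map _ (eWord ks)) [] N) (+-identityʳ _))) ⟩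
        Λ (map _ (eWord ks)) N + Λ (map _ (eWord ks)) N
          ≈⟨ +-cong (Λ-prefix _ ℚ.1ℚ (+ 0) (replicate (suc k) a ++ [ b ]) (λ _ _ _ → P.refl) (eWord ks) N)
                    (Λ-prefix _ ℚ.1ℚ (+ 1) (replicate k a ++ [ b ]) (λ _ _ _ → P.refl) (eWord ks) N) ⟩
        scalar ℚ.1ℚ (+ 0) * act (replicate (suc k) a ++ [ b ]) E N + scalar ℚ.1ℚ (+ 1) * act (replicate k a ++ [ b ]) E N
          ≈⟨ +-cong (*-cong scalar-1-0 (act-cong (replicate (suc k) a ++ [ b ]) (Λ-eWord ks) N))
                    (*-cong scalar-1-1 (act-cong (replicate k a ++ [ b ]) (Λ-eWord ks) N)) ⟩
        1# * act (replicate (suc k) a ++ [ b ]) (Lw ks) N + ℏ * act (replicate k a ++ [ b ]) (Lw ks) N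
          ≈⟨ trans (+-congʳ (*-identityˡ _)) (sym (Lw-pos (suc k) k≥1 ks N)) ⟩
        Lw (pos (suc k) k≥1 ∷ ks) N ∎
        where E = Λ (eWord ks)

      Λ-ι : ∀ u → Λ (ι u) ≈ₛ L u
      Λ-ι []                  N = refl
      Λ-ι ((c , n , ks) ∷ u) N = begin
        Λ (map _ (eWord ks) ++ ι u) N
          ≈⟨ Λ-++ (map _ (eWord ks)) (ι u) N ⟩
        Λ (map _ (eWord ks)) N + Λ (ι u) N
          ≈⟨ +-cong (Λ-prefix _ c n [] (λ _ _ _ → P.refl) (eWord ks) N) (Λ-ι u N) ⟩
        scalar c n * Λ (eWord ks) N + L u N
          ≈⟨ +-congʳ (*-congˡ (Λ-eWord ks N)) ⟩
        L ((c , n , ks) ∷ u) N ∎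

proposition4p2 : {c ℓ : Level} (R : CommutativeRing c ℓ)
    (φ : ℚ → CommutativeRing.Carrier R) →
    RingMorphisms.IsRingHomomorphism +-*-rawRing (CommutativeRing.rawRing R) φ →
    (q : CommutativeRing.Carrier R) (inv : ℕ → CommutativeRing.Carrier R) (hinv : CommutativeRing.Carrier R) →
    let open CommutativeRing R
        open Setup R φ q inv hinv
    in (∀ (m : ℕ) → qint (suc m) * inv (suc m) ≈ 1#) →
       (1# - q) * hinv ≈ 1# →
       ∀ (w w' u : EPoly) → ι u ≈ₕ (ι w ⧢ℏ ι w') →
       L u ≈ₛ (L w ⋆ L w')
proposition4p2 R φ φ-hom q inv hinv qint-inv ℏ*hinv≈1 w w' u u≈w⧢w' N = begin
  L u N                        ≈⟨ sym (Λ-ι u N) ⟩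
  Λ (ι u) N                    ≈⟨ Λ-resp (ι u) (ι w ⧢ℏ ι w') u≈w⧢w' N ⟩
  Λ (ι w ⧢ℏ ι w') N            ≈⟨ Λ-bilinear _ (λ c n u c' n' u' → Λ-shuffleTerm _ c n u c' n' u' (λ _ _ → P.refl))
                                           (ι w) (ι w') (admissible-ι w) (admissible-ι w') N ⟩
  (Λ (ι w) ⋆ Λ (ι w')) N       ≈⟨ ⋆-cong (Λ-ι w) (Λ-ι w') N ⟩
  (L w ⋆ L w') N               ∎
  where
  open CommutativeRing R
  open Setup R φ q inv hinv using (L; _⋆_)
  open RingMorphisms.IsRingHomomorphism φ-hom using (+-homo; *-homo; 0#-homo; 1#-homo)
  open Realization R φ q inv hinv
  open WithQInverses qint-inv
  open Linear +-homo *-homo 0#-homo 1#-homo ℏ*hinv≈1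
  open import Relation.Binary.Reasoning.Setoid setoid
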